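{- For every odd integer $\ell \geq 3$ there exists $\delta = \delta(\ell) > 0$ such that for every sufficiently large integer $n$ there exists an $n$-vertex (undirected) graph $G$ with no odd cycle of length at most $\ell$ such that for every finite field $\mathbb{F}$, $\mathrm{minrk}_{\mathbb{F}}(G) \leq n^{1-\delta}$. Moreover, for every finite field $\mathbb{F}$ this bound is attained by a symmetric matrix, i.e., there is a symmetric matrix over $\mathbb{F}$ representing $G$ of rank at most $n^{1-\delta}$.
   Context: Let $G$ be a graph on vertex set $[n]$ and $\mathbb{F}$ a field. An $n\times n$ matrix $M$ over $\mathbb{F}$ represents $G$ if $M_{i,i}\neq 0$ for every $i$ and $M_{i,j}=0$ for every pair of distinct non-adjacent vertices $i,j$. The minrank $\mathrm{minrk}_{\mathbb{F}}(G)$ is the minimum rank over $\mathbb{F}$ of a matrix representing $G$. -}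

module Defs where

open import Level using (0ℓ)
open import Data.Nat using (ℕ; zero; suc; _≤_; _%_)
import Data.Nat as ℕ
open import Data.Bool using (Bool; true; false)
open import Data.Fin using (Fin; zero; suc; inject₁; fromℕ)
open import Data.Product using (Σ; ∃; _×_; _,_)
open import Relation.Binary.PropositionalEquality using (_≡_)
open import Relation.Nullary using (¬_)
open import Function.Definitions using (Injective)
open import Algebra.Bundles using (CommutativeRing)

record Graph (n : ℕ) : Set where
  field
    adj      : Fin n → Fin n → Bool
    adj-sym  : ∀ i j → adj i j ≡ adj j i
    adj-irr  : ∀ i → adj i i ≡ false

open Graph public

Adjacent : ∀ {n} → Graph n → Fin n → Fin n → Set
Adjacent G i j = adj G i j ≡ true

-- A cycle of length (suc m) in G: pairwise distinct vertices
-- v 0, …, v m with v i ~ v (i+1) and v m ~ v 0.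
-- (Only used with length ≥ 3, where this is the usual notion of cycle.)
record Cycle {n : ℕ} (G : Graph n) (m : ℕ) : Set where
  field
    vtx   : Fin (suc m) → Fin n
    inj   : Injective _≡_ _≡_ vtx
    step  : ∀ (i : Fin m) → Adjacent G (vtx (inject₁ i)) (vtx (suc i))
    close : Adjacent G (vtx (fromℕ m)) (vtx zero)

Odd : ℕ → Set
Odd k = k % 2 ≡ 1

NoShortOddCycle : ∀ {n} → Graph n → ℕ → Set
NoShortOddCycle G ℓ =
  ∀ (m : ℕ) → 3 ≤ suc m → suc m ≤ ℓ → Odd (suc m) → ¬ Cycle G m

record Field : Set₁ where
  field
    commRing : CommutativeRing 0ℓ 0ℓ
  open CommutativeRing commRing public
  field
    0≉1     : ¬ (0# ≈ 1#)
    inverse : ∀ x → ¬ (x ≈ 0#) → ∃ λ y → x * y ≈ 1#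

record FiniteField : Set₁ where
  field
    field′ : Field
  open Field field′ public
  field
    size     : ℕ
    enum     : Fin size → Carrier
    enum-sur : ∀ x → ∃ λ i → enum i ≈ x

module _ (F : Field) where
  open Field F using (Carrier; _≈_; _+_; _*_; 0#)

  Matrix : ℕ → ℕ → Set
  Matrix a b = Fin a → Fin b → Carrier

  sumFin : ∀ r → (Fin r → Carrier) → Carrier
  sumFin zero    f = 0#
  sumFin (suc r) f = f zero + sumFin r (λ k → f (suc k))

  RankAtMost : ∀ {a b} → Matrix a b → ℕ → Set
  RankAtMost {a} {b} M r =
    Σ (Matrix a r) λ A → Σ (Matrix r b) λ B →
      ∀ i j → M i j ≈ sumFin r (λ k → A i k * B k j)

  Symmetric : ∀ {n} → Matrix n n → Set
  Symmetric M = ∀ i j → M i j ≈ M j i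

  Represents : ∀ {n} → Matrix n n → Graph n → Set
  Represents M G =
    (∀ i → ¬ (M i i ≈ 0#)) ×
    (∀ i j → ¬ (i ≡ j) → adj G i j ≡ false → M i j ≈ 0#)

  MinrkAtMost : ∀ {n} → Graph n → ℕ → Set
  MinrkAtMost {n} G r = Σ (Matrix n n) λ M → Represents M G × RankAtMost M r

  SymMinrkAtMost : ∀ {n} → Graph n → ℕ → Set
  SymMinrkAtMost {n} G r =
    Σ (Matrix n n) λ M → Symmetric M × Represents M G × RankAtMost M r

-- r ≤ n^(1 - p/q) for naturals r, n and q > 0, written without reals:
-- r^q ≤ n^(q-p)  ⇔  r^q · n^p ≤ n^q.
BoundedBy : ℕ → ℕ → ℕ → ℕ → Set
BoundedBy r n p q = (r ℕ.^ q) ℕ.* (n ℕ.^ p) ≤ n ℕ.^ q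

{-# OPTIONS --safe #-}
module Submission where

-- Label each vertex by a colour in Fin m and a binary word of length k and weight w, and join two
-- vertices when they have the same colour and their words agree in at most T coordinates.
-- Agreement is Hamming distance to the complement, so after j steps of a walk the word is within
-- Hamming distance jT of the starting word, or of its complement when j is odd; closing an odd
-- walk costs k = agree(x, x) ≤ (length)·T, so there is no odd cycle of length ≤ ℓ when Tℓ < k.
-- With k = T + 2D, the matrix [same colour] · ψ_D(|x ∖ y|), where ψ_D(y) = Σ_{i<D} (-1)^i (y choose i),
-- represents the graph over every field: distinct non-adjacent words of equal weight have
-- 0 < |x ∖ y| < D.  Its rank is at most m Σ_{j<D} (k choose j), and for D = 2ℓf, w = D + f,
-- k = 4(ℓ+1)f the ratio of consecutive binomial coefficients below w is at most (2ℓ+1)/(2ℓ+3),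
-- so this is exponentially smaller in f than the m (k choose w) ≥ n vertices; f ≈ log n then
-- gives rank ≤ n^(1-δ).

open import Defs
open import Data.Nat using (ℕ; suc; _≤_; _<_)
import Data.Nat as ℕ
open import Data.Product using (Σ; ∃; _×_)
open import Data.Bool using (Bool)
open import Data.Fin using (Fin)
open import Data.Vec using (Vec)
open import Function.Definitions using (Injective)
open import Relation.Binary.PropositionalEquality using (_≡_)

module Words where

  open import Data.Nat using (zero; _+_; _*_; z≤n; s≤s)
  open import Data.Nat.Properties
    using (+-mono-≤; ≤-trans; ≤-reflexive; +-cancelˡ-≡; +-commutativeSemigroup; module ≤-Reasoning)
  open import Algebra.Properties.CommutativeSemigroup +-commutativeSemigroup using (interchange)
  open import Data.Bool using (Bool; true; false; not; _∧_; _xor_)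
  open import Data.Bool.Properties using (not-involutive)
  open import Data.Bool.Solver using (module xor-∧-Solver)
  open import Data.Fin using (Fin; zero; suc; inject₁; fromℕ)
  open import Data.Vec using (Vec; []; _∷_)
  open import Relation.Binary.PropositionalEquality

  bit : Bool → ℕ
  bit true  = 1
  bit false = 0

  count : ∀ {k} → (Bool → Bool → Bool) → Vec Bool k → Vec Bool k → ℕ
  count p []      []      = 0
  count p (a ∷ x) (b ∷ y) = bit (p a b) + count p x y

  module _ {p : Bool → Bool → Bool} where

    count-sym : (∀ a b → p a b ≡ p b a) → ∀ {k} (x y : Vec Bool k) → count p x y ≡ count p y x
    count-sym p-sym []      []      = refl
    count-sym p-sym (a ∷ x) (b ∷ y) = cong₂ _+_ (cong bit (p-sym a b)) (count-sym p-sym x y)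

    count-flip : ∀ {k} (x y : Vec Bool k) → count p x y ≡ count (λ a b → p b a) y x
    count-flip []      []      = refl
    count-flip (a ∷ x) (b ∷ y) = cong (bit (p a b) +_) (count-flip x y)

    count-refl : (∀ a → p a a ≡ true) → ∀ {k} (x : Vec Bool k) → count p x x ≡ k
    count-refl p-refl []      = refl
    count-refl p-refl (a ∷ x) = cong₂ _+_ (cong bit (p-refl a)) (count-refl p-refl x)

    count-irrefl : (∀ a → p a a ≡ false) → ∀ {k} (x : Vec Bool k) → count p x x ≡ 0
    count-irrefl p-irrefl []      = refl
    count-irrefl p-irrefl (a ∷ x) = cong₂ _+_ (cong bit (p-irrefl a)) (count-irrefl p-irrefl x)

    count-+ : ∀ {q r} → (∀ a b → bit (p a b) + bit (q a b) ≡ bit (r a b)) →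
              ∀ {k} (x y : Vec Bool k) → count p x y + count q x y ≡ count r x y
    count-+ pq=r []      []      = refl
    count-+ pq=r (a ∷ x) (b ∷ y) =
      trans (interchange (bit (p a b)) _ (bit _) _) (cong₂ _+_ (pq=r a b) (count-+ pq=r x y))

    count-triangle : ∀ {q r} → (∀ a b c → bit (r a c) ≤ bit (p a b) + bit (q b c)) →
                     ∀ {k} (x y z : Vec Bool k) → count r x z ≤ count p x y + count q y z
    count-triangle r≤pq []      []      []      = z≤n
    count-triangle r≤pq (a ∷ x) (b ∷ y) (c ∷ z) =
      ≤-trans (+-mono-≤ (r≤pq a b c) (count-triangle r≤pq x y z))
              (≤-reflexive (interchange (bit (p a b)) _ _ _))

  count-true : ∀ {k} (x y : Vec Bool k) → count (λ _ _ → true) x y ≡ k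
  count-true []      []      = refl
  count-true (a ∷ x) (b ∷ y) = cong suc (count-true x y)

  distance : ∀ {k} → Bool → Vec Bool k → Vec Bool k → ℕ
  distance s = count (λ a b → s xor (a xor b))

  agree hamming : ∀ {k} → Vec Bool k → Vec Bool k → ℕ
  agree   = distance true
  hamming = distance false

  distance-sym : ∀ s {k} (x y : Vec Bool k) → distance s x y ≡ distance s y x
  distance-sym s = count-sym (λ a b → cong (s xor_) (xor-comm a b))
    where open import Data.Bool.Properties using (xor-comm)

  agree-refl : ∀ {k} (x : Vec Bool k) → agree x x ≡ k
  agree-refl = count-refl λ { true → refl ; false → refl }

  hamming-refl : ∀ {k} (x : Vec Bool k) → hamming x x ≡ 0
  hamming-refl = count-irrefl λ { true → refl ; false → refl }

  distance-triangle : ∀ s t {k} (x y z : Vec Bool k) →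
                      distance (s xor t) x z ≤ distance s x y + distance t y z
  distance-triangle s t = count-triangle λ a b c →
    ≤-trans (≤-reflexive (cong bit (interchange-xor a b c))) (bit-xor (s xor (a xor b)) (t xor (b xor c)))
    where
    open xor-∧-Solver
    interchange-xor : ∀ a b c → (s xor t) xor (a xor c) ≡ (s xor (a xor b)) xor (t xor (b xor c))
    interchange-xor = solve 5 (λ s t a b c → (s :+ t) :+ (a :+ c) := (s :+ (a :+ b)) :+ (t :+ (b :+ c))) refl s t
    bit-xor : ∀ u v → bit (u xor v) ≤ bit u + bit v
    bit-xor true  true  = z≤n
    bit-xor true  false = s≤s z≤n
    bit-xor false v     = ≤-reflexive refl

  hamming≡0⇒≡ : ∀ {k} (x y : Vec Bool k) → hamming x y ≡ 0 → x ≡ y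
  hamming≡0⇒≡ []          []          _ = refl
  hamming≡0⇒≡ (true ∷ x)  (true ∷ y)  h = cong (true ∷_) (hamming≡0⇒≡ x y h)
  hamming≡0⇒≡ (false ∷ x) (false ∷ y) h = cong (false ∷_) (hamming≡0⇒≡ x y h)

  agree+hamming : ∀ {k} (x y : Vec Bool k) → agree x y + hamming x y ≡ k
  agree+hamming x y = trans (count-+ pointwise x y) (count-true x y)
    where
    pointwise : ∀ a b → bit (not (a xor b)) + bit (a xor b) ≡ 1
    pointwise true  true  = refl
    pointwise true  false = refl
    pointwise false true  = refl
    pointwise false false = refl

  weight : ∀ {k} → Vec Bool k → ℕ
  weight []      = 0
  weight (a ∷ x) = bit a + weight x

  -- The size of x ∖ y, reading words as subsets.
  excess : ∀ {k} → Vec Bool k → Vec Bool k → ℕ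
  excess = count (λ a b → a ∧ not b)

  excess-refl : ∀ {k} (x : Vec Bool k) → excess x x ≡ 0
  excess-refl = count-irrefl λ { true → refl ; false → refl }

  weight+excess : ∀ {k} (x y : Vec Bool k) → weight x + excess y x ≡ weight y + excess x y
  weight+excess []      []      = refl
  weight+excess (a ∷ x) (b ∷ y) = begin
    (bit a + weight x) + (bit (b ∧ not a) + excess y x) ≡⟨ interchange (bit a) _ _ _ ⟩
    (bit a + bit (b ∧ not a)) + (weight x + excess y x) ≡⟨ cong₂ _+_ (pointwise a b) (weight+excess x y) ⟩
    (bit b + bit (a ∧ not b)) + (weight y + excess x y) ≡⟨ interchange (bit b) _ _ _ ⟩
    (bit b + weight y) + (bit (a ∧ not b) + excess x y) ∎
    where
    open ≡-Reasoning
    pointwise : ∀ a b → bit a + bit (b ∧ not a) ≡ bit b + bit (a ∧ not b)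
    pointwise true  true  = refl
    pointwise true  false = refl
    pointwise false true  = refl
    pointwise false false = refl

  excess+excess : ∀ {k} (x y : Vec Bool k) → excess x y + excess y x ≡ hamming x y
  excess+excess x y = trans (cong (excess x y +_) (count-flip y x)) (count-+ pointwise x y)
    where
    pointwise : ∀ a b → bit (a ∧ not b) + bit (b ∧ not a) ≡ bit (a xor b)
    pointwise true  true  = refl
    pointwise true  false = refl
    pointwise false true  = refl
    pointwise false false = refl

  module _ {k} (x y : Vec Bool k) (same-weight : weight x ≡ weight y) where

    excess-sym : excess x y ≡ excess y x
    excess-sym = sym (+-cancelˡ-≡ (weight y) _ _
      (trans (cong (_+ excess y x) (sym same-weight)) (weight+excess x y)))

    agree+excess : agree x y + (excess x y + excess x y) ≡ k
    agree+excess = begin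
      agree x y + (excess x y + excess x y) ≡⟨ cong (λ e → agree x y + (excess x y + e)) excess-sym ⟩
      agree x y + (excess x y + excess y x) ≡⟨ cong (agree x y +_) (excess+excess x y) ⟩
      agree x y + hamming x y               ≡⟨ agree+hamming x y ⟩
      k ∎
      where open ≡-Reasoning

    excess≡0⇒≡ : excess x y ≡ 0 → x ≡ y
    excess≡0⇒≡ e≡0 = hamming≡0⇒≡ x y (begin
      hamming x y               ≡⟨ sym (excess+excess x y) ⟩
      excess x y + excess y x   ≡⟨ cong₂ _+_ e≡0 (trans (sym excess-sym) e≡0) ⟩
      0 ∎)
      where open ≡-Reasoning

  oddᵇ : ℕ → Bool
  oddᵇ zero    = false
  oddᵇ (suc n) = not (oddᵇ n)

  -- suc (suc n) % 2 computes to n % 2.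
  Odd⇒oddᵇ : ∀ n → Odd n → oddᵇ n ≡ true
  Odd⇒oddᵇ 1             _   = refl
  Odd⇒oddᵇ (suc (suc n)) odd = trans (not-involutive (oddᵇ n)) (Odd⇒oddᵇ n odd)

  module _ {k T : ℕ} where

    walk-distance : ∀ j (x : Fin (suc j) → Vec Bool k) →
                    (∀ i → agree (x (inject₁ i)) (x (suc i)) ≤ T) →
                    distance (oddᵇ j) (x (fromℕ j)) (x zero) ≤ j * T
    walk-distance zero    x steps = ≤-reflexive (hamming-refl (x zero))
    walk-distance (suc j) x steps = begin
      distance (oddᵇ (suc j)) (x (fromℕ (suc j))) (x zero)
        ≤⟨ distance-triangle true (oddᵇ j) (x (suc (fromℕ j))) (x (inject₁ (fromℕ j))) (x zero) ⟩
      agree (x (suc (fromℕ j))) (x (inject₁ (fromℕ j))) + distance (oddᵇ j) (x (inject₁ (fromℕ j))) (x zero)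
        ≤⟨ +-mono-≤ (≤-trans (≤-reflexive (distance-sym true (x (suc (fromℕ j))) (x (inject₁ (fromℕ j))))) (steps (fromℕ j)))
                    (walk-distance j (λ i → x (inject₁ i)) (λ i → steps (inject₁ i))) ⟩
      T + j * T ∎
      where open ≤-Reasoning

    odd-closed-walk : ∀ m (x : Fin (suc m) → Vec Bool k) →
                      (∀ i → agree (x (inject₁ i)) (x (suc i)) ≤ T) →
                      agree (x (fromℕ m)) (x zero) ≤ T → Odd (suc m) → k ≤ suc m * T
    odd-closed-walk m x steps close odd = begin
      k
        ≡⟨ sym (agree-refl (x zero)) ⟩
      agree (x zero) (x zero)
        ≡⟨ cong (λ s → distance s (x zero) (x zero)) (sym (Odd⇒oddᵇ (suc m) odd)) ⟩
      distance (oddᵇ (suc m)) (x zero) (x zero)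
        ≤⟨ distance-triangle true (oddᵇ m) (x zero) (x (fromℕ m)) (x zero) ⟩
      agree (x zero) (x (fromℕ m)) + distance (oddᵇ m) (x (fromℕ m)) (x zero)
        ≤⟨ +-mono-≤ (≤-trans (≤-reflexive (distance-sym true (x zero) (x (fromℕ m)))) close) (walk-distance m x steps) ⟩
      T + m * T ∎
      where open ≤-Reasoning

module Binomial where

  open import Data.Nat using (zero; _+_; _*_; _^_; z≤n; s≤s)
  open import Data.Nat.Properties
  open import Data.Nat.Solver using (module +-*-Solver)
  open import Data.Bool using (Bool; true; false)
  open import Data.Fin using (Fin; zero; splitAt; join)
  open import Data.Fin.Properties using (join-splitAt)
  open import Data.Sum using (inj₁; inj₂; [_,_]′)
  open import Data.Vec using (Vec; _∷_; replicate)
  open import Data.Vec.Properties using (∷-injectiveˡ; ∷-injectiveʳ)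
  open import Function using (_∘_)
  open import Function.Definitions using (Injective)
  open import Relation.Binary.PropositionalEquality
  open +-*-Solver
  open Words using (weight)

  infix 10 _choose_ _choose<_

  _choose_ : ℕ → ℕ → ℕ
  k     choose zero  = 1
  zero  choose suc j = 0
  suc k choose suc j = k choose j + k choose suc j

  -- Σ_{j<D} (k choose j), by the recursion which the factorisation of ψ below follows.
  _choose<_ : ℕ → ℕ → ℕ
  k     choose< zero  = 0
  zero  choose< suc D = 1
  suc k choose< suc D = k choose< suc D + k choose< D

  ofWeight : ∀ k j → Fin (k choose j) → Vec Bool k
  ofWeight k       zero    _ = replicate k false
  ofWeight (suc k) (suc j) t =
    [ (true ∷_) ∘ ofWeight k j , (false ∷_) ∘ ofWeight k (suc j) ]′ (splitAt (k choose j) t)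

  weight-ofWeight : ∀ k j t → weight (ofWeight k j t) ≡ j
  weight-ofWeight k       zero    _ = weight-replicate k
    where
    weight-replicate : ∀ k → weight (replicate k false) ≡ 0
    weight-replicate zero    = refl
    weight-replicate (suc k) = weight-replicate k
  weight-ofWeight (suc k) (suc j) t with splitAt (k choose j) t
  ... | inj₁ t′ = cong suc (weight-ofWeight k j t′)
  ... | inj₂ t′ = weight-ofWeight k (suc j) t′

  ofWeight-injective : ∀ k j → Injective _≡_ _≡_ (ofWeight k j)
  ofWeight-injective k       zero    {zero} {zero} _ = refl
  ofWeight-injective (suc k) (suc j) {t} {t′} eq = begin
    t                    ≡⟨ join-splitAt m _ t ⟨
    join m _ (split t)   ≡⟨ cong (join m _) (tagged-injective (split t) (split t′) eq) ⟩
    join m _ (split t′)  ≡⟨ join-splitAt m _ t′ ⟩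
    t′ ∎
    where
    open ≡-Reasoning
    m = k choose j
    split = splitAt m
    tag = [ (true ∷_) ∘ ofWeight k j , (false ∷_) ∘ ofWeight k (suc j) ]′
    tagged-injective : ∀ u v → tag u ≡ tag v → u ≡ v
    tagged-injective (inj₁ a) (inj₁ b) e = cong inj₁ (ofWeight-injective k j (∷-injectiveʳ e))
    tagged-injective (inj₂ a) (inj₂ b) e = cong inj₂ (ofWeight-injective k (suc j) (∷-injectiveʳ e))
    tagged-injective (inj₁ a) (inj₂ b) e with () ← ∷-injectiveˡ e
    tagged-injective (inj₂ a) (inj₁ b) e with () ← ∷-injectiveˡ e

  choose>0 : ∀ {k j} → j ≤ k → 0 < k choose j
  choose>0 {k}     {zero}  _         = s≤s z≤n
  choose>0 {suc k} {suc j} (s≤s j≤k) = ≤-trans (choose>0 j≤k) (m≤m+n _ _)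

  choose≤2^ : ∀ k j → k choose j ≤ 2 ^ k
  choose≤2^ k       zero    = m^n>0 2 k
  choose≤2^ zero    (suc j) = z≤n
  choose≤2^ (suc k) (suc j) =
    ≤-trans (+-mono-≤ (choose≤2^ k j) (choose≤2^ k (suc j))) (≤-reflexive (cong (2 ^ k +_) (sym (+-identityʳ _))))

  choose<-suc : ∀ k D → k choose< suc D ≡ k choose< D + k choose D
  choose<-suc zero    zero    = refl
  choose<-suc zero    (suc D) = refl
  choose<-suc (suc k) zero    = cong (_+ 0) (choose<-suc k zero)
  choose<-suc (suc k) (suc D) = begin
    k choose< suc (suc D) + k choose< suc D
      ≡⟨ cong₂ _+_ (choose<-suc k (suc D)) (choose<-suc k D) ⟩
    (k choose< suc D + k choose suc D) + (k choose< D + k choose D)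
      ≡⟨ solve 4 (λ a b c d → (a :+ b) :+ (c :+ d) := (a :+ c) :+ (d :+ b)) refl
               (k choose< suc D) (k choose suc D) (k choose< D) (k choose D) ⟩
    (k choose< suc D + k choose< D) + (k choose D + k choose suc D) ∎
    where open ≡-Reasoning

  -- The absorption identity (k choose j) (k - j) = (k choose j+1) (j+1), without truncated subtraction.
  choose-absorption : ∀ k j → k choose j * k ≡ k choose j * j + k choose suc j * suc j
  choose-absorption zero    zero    = refl
  choose-absorption zero    (suc j) = refl
  choose-absorption (suc k) zero    = cong suc (choose-absorption k zero)
  choose-absorption (suc k) (suc j) = begin
    (a + b) * suc k
      ≡⟨ solve 3 (λ a b k → (a :+ b) :* (con 1 :+ k) := a :* k :+ b :* k :+ a :+ b) refl a b k ⟩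
    a * k + b * k + a + b
      ≡⟨ cong (λ e → e + a + b) (cong₂ _+_ (choose-absorption k j) (choose-absorption k (suc j))) ⟩
    (a * j + b * suc j) + (b * suc j + c * suc (suc j)) + a + b
      ≡⟨ solve 4 (λ a b c j → (a :* j :+ b :* (con 1 :+ j)) :+ (b :* (con 1 :+ j) :+ c :* (con 2 :+ j)) :+ a :+ b
                            := (a :+ b) :* (con 1 :+ j) :+ (b :+ c) :* (con 2 :+ j)) refl a b c j ⟩
    (a + b) * suc j + (b + c) * suc (suc j) ∎
    where
    open ≡-Reasoning
    a = k choose j
    b = k choose suc j
    c = k choose suc (suc j)

  module _ {k α β : ℕ} where

    choose-step : ∀ j → suc j * β + j * α ≤ k * α → k choose j * β ≤ k choose suc j * α
    choose-step j cond = *-cancelʳ-≤ _ _ (suc j) (+-cancelʳ-≤ (c * j * α) _ _ (begin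
      c * β * suc j + c * j * α
        ≡⟨ solve 4 (λ c β j α → c :* β :* (con 1 :+ j) :+ c :* j :* α := c :* ((con 1 :+ j) :* β :+ j :* α)) refl c β j α ⟩
      c * (suc j * β + j * α)
        ≤⟨ *-monoʳ-≤ c cond ⟩
      c * (k * α)
        ≡⟨ *-assoc c k α ⟨
      c * k * α
        ≡⟨ cong (_* α) (choose-absorption k j) ⟩
      (c * j + c′ * suc j) * α
        ≡⟨ solve 4 (λ c c′ j α → (c :* j :+ c′ :* (con 1 :+ j)) :* α := c′ :* α :* (con 1 :+ j) :+ c :* j :* α) refl c c′ j α ⟩
      c′ * α * suc j + c * j * α ∎))
      where
      open ≤-Reasoning
      c  = k choose j
      c′ = k choose suc j

    -- The hypothesis says (j+i)/(k-(j+i)) ≤ α/β, which bounds (k choose t)/(k choose t+1) for all t < j + i.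
    choose-chain : ∀ j i → (j + i) * β + (j + i) * α ≤ k * α →
                   k choose j * β ^ i ≤ k choose (j + i) * α ^ i
    choose-chain j zero    _    = ≤-reflexive (cong (λ e → k choose e * 1) (sym (+-identityʳ j)))
    choose-chain j (suc i) cond = begin
      k choose j * (β * β ^ i)
        ≡⟨ *-assoc (k choose j) β (β ^ i) ⟨
      k choose j * β * β ^ i
        ≤⟨ *-monoˡ-≤ (β ^ i) (choose-step j step-cond) ⟩
      k choose suc j * α * β ^ i
        ≡⟨ solve 3 (λ c α b → c :* α :* b := α :* (c :* b)) refl (k choose suc j) α (β ^ i) ⟩
      α * (k choose suc j * β ^ i)
        ≤⟨ *-monoʳ-≤ α (choose-chain (suc j) i (subst (λ e → e * β + e * α ≤ k * α) (+-suc j i) cond)) ⟩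
      α * (k choose suc (j + i) * α ^ i)
        ≡⟨ solve 3 (λ c α a → α :* (c :* a) := c :* (α :* a)) refl (k choose suc (j + i)) α (α ^ i) ⟩
      k choose suc (j + i) * (α * α ^ i)
        ≡⟨ cong (λ e → k choose e * (α * α ^ i)) (+-suc j i) ⟨
      k choose (j + suc i) * (α * α ^ i) ∎
      where
      open ≤-Reasoning
      j<j+suc-i : suc j ≤ j + suc i
      j<j+suc-i = ≤-trans (s≤s (m≤m+n j i)) (≤-reflexive (sym (+-suc j i)))
      step-cond : suc j * β + j * α ≤ k * α
      step-cond = ≤-trans (+-mono-≤ (*-monoˡ-≤ β j<j+suc-i) (*-monoˡ-≤ α (<⇒≤ j<j+suc-i))) cond

  choose-increasing : ∀ {k} j → suc (j + j) ≤ k → k choose j ≤ k choose suc j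
  choose-increasing {k} j cond = subst₂ _≤_ (*-identityʳ _) (*-identityʳ _)
    (choose-step {k} {1} {1} j (subst₂ _≤_ (solve 1 (λ j → con 1 :+ (j :+ j) := (con 1 :+ j) :* con 1 :+ j :* con 1) refl j)
                                        (sym (*-identityʳ k)) cond))

  choose<≤ : ∀ {k} D → D + D ≤ k → k choose< D ≤ D * k choose D
  choose<≤     zero    _    = z≤n
  choose<≤ {k} (suc D) cond = begin
    k choose< suc D
      ≡⟨ choose<-suc k D ⟩
    k choose< D + k choose D
      ≤⟨ +-monoˡ-≤ _ (choose<≤ D (≤-trans (+-mono-≤ (n≤1+n D) (n≤1+n D)) cond)) ⟩
    D * k choose D + k choose D
      ≡⟨ +-comm (D * k choose D) _ ⟩
    suc D * k choose D
      ≤⟨ *-monoʳ-≤ (suc D) (choose-increasing D (≤-trans (n≤1+n _) (≤-trans (≤-reflexive (cong suc (sym (+-suc D D)))) cond))) ⟩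
    suc D * k choose suc D ∎
    where open ≤-Reasoning

  choose<-decay : ∀ {k α β} D f → D + D ≤ k → (D + f) * β + (D + f) * α ≤ k * α →
                  k choose< D * β ^ f ≤ D * k choose (D + f) * α ^ f
  choose<-decay {k} {α} {β} D f D+D≤k cond = begin
    k choose< D * β ^ f            ≤⟨ *-monoˡ-≤ (β ^ f) (choose<≤ D D+D≤k) ⟩
    D * k choose D * β ^ f         ≡⟨ *-assoc D _ _ ⟩
    D * (k choose D * β ^ f)       ≤⟨ *-monoʳ-≤ D (choose-chain D f cond) ⟩
    D * (k choose (D + f) * α ^ f) ≡⟨ *-assoc D _ _ ⟨
    D * k choose (D + f) * α ^ f ∎
    where open ≤-Reasoning

module Factorisation (F : Field) where

  open import Data.Nat as ℕ using (zero; s≤s)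
  open import Data.Bool using (Bool; true; false; not; if_then_else_)
  open import Data.Fin using (Fin; zero; suc; _↑ˡ_; _↑ʳ_; _≟_)
  open import Data.Vec using (Vec; []; _∷_; head; tail)
  open import Data.Vec.Functional using (Vector; _++_)
  open import Data.Vec.Functional.Properties using (lookup-++ˡ; lookup-++ʳ)
  open import Function using (_∘_; mk⇔)
  open import Data.Product using (_,_)
  open import Relation.Nullary.Decidable using (does; does-⇔; dec-true)
  open import Relation.Binary.PropositionalEquality as ≡ using (_≡_)
  open Field F hiding (zero)
  open import Algebra.Properties.Ring ring using (-0#≈0#; -1*x≈-x)
  open import Algebra.Properties.CommutativeSemigroup *-commutativeSemigroup using (interchange)
  open import Algebra.Properties.Semiring.Sum semiring
    using (sum; sum-syntax; sum-cong-≋; *-distribˡ-sum; *-distribʳ-sum; sum-replicate-zero)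
  open import Relation.Binary.Reasoning.Setoid setoid
  open Binomial using (_choose<_)
  open Words using (excess)

  Factorises : ∀ {I J : Set} → (I → J → Carrier) → ℕ → Set
  Factorises {I} {J} M r =
    Σ (I → Fin r → Carrier) λ A → Σ (Fin r → J → Carrier) λ B →
      ∀ i j → M i j ≈ ∑[ t < r ] (A i t * B t j)

  module _ {I J : Set} where

    factorises-cong : ∀ {M N : I → J → Carrier} {r} → (∀ i j → M i j ≈ N i j) →
                      Factorises M r → Factorises N r
    factorises-cong M≈N (A , B , M≈AB) = A , B , λ i j → trans (sym (M≈N i j)) (M≈AB i j)

    factorises-reindex : ∀ {I′ J′ : Set} {M : I → J → Carrier} {r} (f : I′ → I) (g : J′ → J) →
                         Factorises M r → Factorises (λ i j → M (f i) (g j)) r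
    factorises-reindex f g (A , B , M≈AB) = A ∘ f , (λ t → B t ∘ g) , λ i j → M≈AB (f i) (g j)

    factorises-0 : Factorises {I} {J} (λ _ _ → 0#) 0
    factorises-0 = (λ _ ()) , (λ ()) , λ _ _ → refl

    factorises-+ : ∀ {M N : I → J → Carrier} {r s} → Factorises M r → Factorises N s →
                   Factorises (λ i j → M i j + N i j) (r ℕ.+ s)
    factorises-+ {M} {N} {r} {s} (A , B , M≈AB) (A′ , B′ , N≈AB′) =
      (λ i → A i ++ A′ i) , (λ t j → (col B j ++ col B′ j) t) , λ i j → begin
        M i j + N i j
          ≈⟨ +-cong (M≈AB i j) (N≈AB′ i j) ⟩
        ∑[ t < r ] (A i t * B t j) + ∑[ t < s ] (A′ i t * B′ t j)
          ≈⟨ +-cong (sum-cong-≋ {r} (left i j)) (sum-cong-≋ {s} (right i j)) ⟨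
        ∑[ t < r ] AB i j (t ↑ˡ s) + ∑[ t < s ] AB i j (r ↑ʳ t)
          ≈⟨ sum-↑ r (AB i j) ⟨
        ∑[ t < r ℕ.+ s ] AB i j t ∎
      where
      col : ∀ {n} → (Fin n → J → Carrier) → J → Vector Carrier n
      col B j t = B t j
      AB : I → J → Vector Carrier (r ℕ.+ s)
      AB i j t = (A i ++ A′ i) t * (col B j ++ col B′ j) t
      left : ∀ i j t → AB i j (t ↑ˡ s) ≈ A i t * B t j
      left i j t = reflexive (≡.cong₂ _*_ (lookup-++ˡ (A i) (A′ i) t) (lookup-++ˡ (col B j) (col B′ j) t))
      right : ∀ i j t → AB i j (r ↑ʳ t) ≈ A′ i t * B′ t j
      right i j t = reflexive (≡.cong₂ _*_ (lookup-++ʳ (A i) (A′ i) t) (lookup-++ʳ (col B j) (col B′ j) t))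
      sum-↑ : ∀ r {s} (f : Vector Carrier (r ℕ.+ s)) →
              sum f ≈ sum (f ∘ (_↑ˡ s)) + sum (f ∘ (r ↑ʳ_))
      sum-↑ zero    f = sym (+-identityˡ _)
      sum-↑ (suc r) f = trans (+-congˡ (sum-↑ r (f ∘ suc))) (sym (+-assoc _ _ _))

    factorises-scale : ∀ {M : I → J → Carrier} {r} (α : I → Carrier) (β : J → Carrier) →
                       Factorises M r → Factorises (λ i j → (α i * β j) * M i j) r
    factorises-scale {M} {r} α β (A , B , M≈AB) =
      (λ i t → α i * A i t) , (λ t j → β j * B t j) , λ i j → begin
        (α i * β j) * M i j                         ≈⟨ *-congˡ (M≈AB i j) ⟩
        (α i * β j) * ∑[ t < r ] (A i t * B t j)    ≈⟨ *-distribˡ-sum (α i * β j) (λ t → A i t * B t j) ⟩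
        ∑[ t < r ] ((α i * β j) * (A i t * B t j))  ≈⟨ sum-cong-≋ {r} (λ t → interchange (α i) (β j) (A i t) (B t j)) ⟩
        ∑[ t < r ] ((α i * A i t) * (β j * B t j))  ∎

    factorises-sum : ∀ {m R} {M : Fin m → I → J → Carrier} → (∀ a → Factorises (M a) R) →
                     Factorises (λ i j → ∑[ a < m ] M a i j) (m ℕ.* R)
    factorises-sum {zero}  _   = factorises-0
    factorises-sum {suc m} fac = factorises-+ (fac zero) (factorises-sum (fac ∘ suc))

  δ : ∀ {m} → Fin m → Fin m → Carrier
  δ a b = if does (a ≟ b) then 1# else 0#

  δ-refl : ∀ {m} (a : Fin m) → δ a a ≈ 1#
  δ-refl a rewrite dec-true (a ≟ a) ≡.refl = refl

  δ-sym : ∀ {m} (a b : Fin m) → δ a b ≈ δ b a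
  δ-sym a b = reflexive (≡.cong (if_then 1# else 0#) (does-⇔ (mk⇔ ≡.sym ≡.sym) (a ≟ b) (b ≟ a)))

  sum-δ : ∀ {m} (a : Fin m) (f : Vector Carrier m) → ∑[ b < m ] (δ a b * f b) ≈ f a
  sum-δ {suc m} zero f = begin
    1# * f zero + ∑[ b < m ] (0# * f (suc b))  ≈⟨ +-cong (*-identityˡ _) (sum-cong-≋ {m} (λ b → zeroˡ (f (suc b)))) ⟩
    f zero + ∑[ b < m ] 0#                      ≈⟨ +-congˡ (sum-replicate-zero m) ⟩
    f zero + 0#                                 ≈⟨ +-identityʳ _ ⟩
    f zero ∎
  sum-δ         (suc a) f = trans (+-cong (zeroˡ _) (sum-δ a (f ∘ suc))) (+-identityˡ _)

  factorises-blocks : ∀ {I J : Set} {m R} {M : I → J → Carrier} (c : I → Fin m) (d : J → Fin m) →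
                      Factorises M R → Factorises (λ i j → δ (c i) (d j) * M i j) (m ℕ.* R)
  factorises-blocks {m = m} {M = M} c d fac =
    factorises-cong collapse (factorises-sum λ a → factorises-scale (λ i → δ (c i) a) (λ j → δ a (d j)) fac)
    where
    collapse : ∀ i j → ∑[ a < m ] ((δ (c i) a * δ a (d j)) * M i j) ≈ δ (c i) (d j) * M i j
    collapse i j = begin
      ∑[ a < m ] ((δ (c i) a * δ a (d j)) * M i j) ≈⟨ *-distribʳ-sum (M i j) (λ a → δ (c i) a * δ a (d j)) ⟨
      ∑[ a < m ] (δ (c i) a * δ a (d j)) * M i j   ≈⟨ *-congʳ (sum-δ (c i) (λ a → δ a (d j))) ⟩
      δ (c i) (d j) * M i j ∎

  factorises⇒RankAtMost : ∀ {a b r} {M : Matrix F a b} → Factorises M r → RankAtMost F M r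
  factorises⇒RankAtMost {r = r} (A , B , M≈AB) =
    A , B , λ i j → trans (M≈AB i j) (reflexive (sum≡sumFin r (λ t → A i t * B t j)))
    where
    sum≡sumFin : ∀ r (f : Vector Carrier r) → sum f ≡ sumFin F r f
    sum≡sumFin zero    f = ≡.refl
    sum≡sumFin (suc r) f = ≡.cong (f zero +_) (sum≡sumFin r (f ∘ suc))

  -- ψ D y = Σ_{i<D} (-1)^i (y choose i), which for y > 0 equals (-1)^(D-1) (y-1 choose D-1).
  ψ : ℕ → ℕ → Carrier
  ψ zero    _       = 0#
  ψ (suc D) zero    = 1#
  ψ (suc D) (suc y) = ψ (suc D) y - ψ D y

  ψ-0 : ∀ {D} → 0 < D → ψ D 0 ≡ 1#
  ψ-0 {suc D} _ = ≡.refl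

  ψ-vanishes : ∀ {D y} → 0 < y → y < D → ψ D y ≈ 0#
  ψ-vanishes {suc D} {suc y} _ (s≤s y<D) = ψ-root y<D
    where
    ψ-root : ∀ {D y} → y < D → ψ (suc D) (suc y) ≈ 0#
    ψ-root {suc D} {zero}  _         = -‿inverseʳ 1#
    ψ-root {suc D} {suc y} (s≤s y<D) = begin
      ψ (suc (suc D)) (suc y) - ψ (suc D) (suc y) ≈⟨ +-cong (ψ-root (m<n⇒m<1+n y<D)) (-‿cong (ψ-root y<D)) ⟩
      0# - 0#                                     ≈⟨ -‿inverseʳ 0# ⟩
      0# ∎
      where open import Data.Nat.Properties using (m<n⇒m<1+n)

  ι : Bool → Carrier
  ι true  = 1#
  ι false = 0#

  ψ-excess-factorises : ∀ k D → Factorises (λ (x y : Vec Bool k) → ψ D (excess x y)) (k choose< D)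
  ψ-excess-factorises k       zero    = factorises-0
  ψ-excess-factorises zero    (suc D) =
    (λ _ _ → 1#) , (λ _ _ → 1#) , λ { [] [] → sym (trans (+-identityʳ _) (*-identityˡ 1#)) }
  ψ-excess-factorises (suc k) (suc D) = factorises-cong expand (factorises-+
    (factorises-reindex tail tail (ψ-excess-factorises k (suc D)))
    (factorises-scale (λ x → - ι (head x)) (λ y → ι (not (head y)))
      (factorises-reindex tail tail (ψ-excess-factorises k D))))
    where
    expand : ∀ (x y : Vec Bool (suc k)) →
             ψ (suc D) (excess (tail x) (tail y)) + ((- ι (head x)) * ι (not (head y))) * ψ D (excess (tail x) (tail y))
             ≈ ψ (suc D) (excess x y)
    expand (true  ∷ x) (true  ∷ y) = trans (+-congˡ (trans (*-congʳ (zeroʳ _)) (zeroˡ _))) (+-identityʳ _)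
    expand (true  ∷ x) (false ∷ y) = +-congˡ (trans (*-congʳ (*-identityʳ _)) (-1*x≈-x _))
    expand (false ∷ x) (c     ∷ y) = trans (+-congˡ (trans (*-congʳ (trans (*-congʳ -0#≈0#) (zeroˡ _))) (zeroˡ _))) (+-identityʳ _)

module Construction {n m k w : ℕ} (T D : ℕ) (label : Fin n → Fin m × Vec Bool k)
                    (label-injective : Injective _≡_ _≡_ label)
                    (weight-label : ∀ i → Words.weight (Data.Product.proj₂ (label i)) ≡ w)
                    (k≡T+2D : k ≡ T ℕ.+ (D ℕ.+ D)) (D>0 : 0 < D) where

  open import Data.Nat using (_+_; _≤?_)
  open import Data.Nat.Properties
    using (≤-trans; ≤-reflexive; *-comm; m≤m+n; m<m+n; +-mono-≤; *-monoˡ-≤; +-monoˡ-<;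
           +-cancelˡ-<; <⇒≱; ≰⇒>; n≢0⇒n>0; module ≤-Reasoning)
  open import Data.Bool using (Bool; true; false)
  open import Data.Fin using (Fin; _≟_)
  open import Data.Product using (_,_; proj₁; proj₂)
  open import Data.Vec using (Vec)
  open import Function using (_∘_; mk⇔)
  open import Function.Definitions using (Injective)
  open import Relation.Nullary using (Dec; yes; no; ¬_; proof; Reflects; invert)
  open import Relation.Nullary.Decidable using (does; _×-dec_; does-⇔; dec-true; dec-false)
  open import Relation.Binary.PropositionalEquality
  open Words
  open Binomial using (_choose<_)

  colour : Fin n → Fin m
  colour = proj₁ ∘ label

  word : Fin n → Vec Bool k
  word = proj₂ ∘ label

  Edge : Fin n → Fin n → Set
  Edge i j = colour i ≡ colour j × agree (word i) (word j) ≤ T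

  edge? : ∀ i j → Dec (Edge i j)
  edge? i j = (colour i ≟ colour j) ×-dec (agree (word i) (word j) ≤? T)

  T<k : T < k
  T<k = ≤-trans (m<m+n T (≤-trans D>0 (m≤m+n D D))) (≤-reflexive (sym k≡T+2D))

  graph : Graph n
  graph = record
    { adj     = λ i j → does (edge? i j)
    ; adj-sym = λ i j → does-⇔ (mk⇔ (edge-sym i j) (edge-sym j i)) (edge? i j) (edge? j i)
    ; adj-irr = λ i → dec-false (edge? i i) λ (_ , agree≤T) →
                  <⇒≱ T<k (≤-trans (≤-reflexive (sym (agree-refl (word i)))) agree≤T)
    }
    where
    edge-sym : ∀ i j → Edge i j → Edge j i
    edge-sym i j (same , agree≤T) = sym same , ≤-trans (≤-reflexive (distance-sym true (word j) (word i))) agree≤T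

  adjacent⇒edge : ∀ {i j} → Adjacent graph i j → Edge i j
  adjacent⇒edge {i} {j} adj = invert (subst (Reflects (Edge i j)) adj (proof (edge? i j)))

  nonadjacent⇒¬edge : ∀ {i j} → adj graph i j ≡ false → ¬ Edge i j
  nonadjacent⇒¬edge {i} {j} nonadj e with () ← trans (sym (dec-true (edge? i j) e)) nonadj

  noShortOddCycle : ∀ ℓ → T ℕ.* ℓ < k → NoShortOddCycle graph ℓ
  noShortOddCycle ℓ Tℓ<k c _ c<ℓ odd cycle = <⇒≱ Tℓ<k (begin
    k             ≤⟨ odd-closed-walk c (word ∘ vtx) (λ i → proj₂ (adjacent⇒edge (step i)))
                                       (proj₂ (adjacent⇒edge close)) odd ⟩
    suc c ℕ.* T   ≤⟨ *-monoˡ-≤ T c<ℓ ⟩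
    ℓ ℕ.* T       ≡⟨ *-comm ℓ T ⟩
    T ℕ.* ℓ ∎)
    where
    open Cycle cycle
    open ≤-Reasoning

  module Representation (F : Field) where

    open Field F using (_≈_; 0#; 1#; 0≉1; _*_; *-cong; zeroˡ; *-identityˡ; reflexive)
                 renaming (sym to ≈-sym; trans to ≈-trans)
    open Factorisation F

    M : Matrix F n n
    M i j = δ (colour i) (colour j) * ψ D (excess (word i) (word j))

    same-weight : ∀ i j → weight (word i) ≡ weight (word j)
    same-weight i j = trans (weight-label i) (sym (weight-label j))

    M-rank : RankAtMost F M (m ℕ.* k choose< D)
    M-rank = factorises⇒RankAtMost
      (factorises-blocks colour colour (factorises-reindex word word (ψ-excess-factorises k D)))

    M-symmetric : Symmetric F M
    M-symmetric i j =
      *-cong (δ-sym (colour i) (colour j)) (reflexive (cong (ψ D) (excess-sym (word i) (word j) (same-weight i j))))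

    M-diagonal : ∀ i → M i i ≈ 1#
    M-diagonal i = ≈-trans (*-cong (δ-refl (colour i)) (reflexive (trans (cong (ψ D) (excess-refl (word i))) (ψ-0 D>0))))
                           (*-identityˡ 1#)

    M-offDiagonal : ∀ i j → i ≢ j → ¬ Edge i j → M i j ≈ 0#
    -- Matching on colour i ≟ colour j also evaluates the factor δ (colour i) (colour j).
    M-offDiagonal i j i≢j ¬edge with colour i ≟ colour j
    ... | no  _        = zeroˡ _
    ... | yes colours≡ = ≈-trans (*-identityˡ _) (ψ-vanishes e>0 e<D)
      where
      x = word i
      y = word j
      e = excess x y
      e>0 : 0 < e
      e>0 = n≢0⇒n>0 λ e≡0 → i≢j (label-injective (cong₂ _,_ colours≡ (excess≡0⇒≡ x y (same-weight i j) e≡0)))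
      e+e<D+D : e + e < D + D
      e+e<D+D = +-cancelˡ-< T _ _ (begin-strict
        T + (e + e)          <⟨ +-monoˡ-< (e + e) (≰⇒> (λ agree≤T → ¬edge (colours≡ , agree≤T))) ⟩
        agree x y + (e + e)  ≡⟨ agree+excess x y (same-weight i j) ⟩
        k                    ≡⟨ k≡T+2D ⟩
        T + (D + D) ∎)
        where open ≤-Reasoning
      e<D : e < D
      e<D = ≰⇒> λ D≤e → <⇒≱ e+e<D+D (+-mono-≤ D≤e D≤e)

    M-represents : Represents F M graph
    M-represents = (λ i Mii≈0 → 0≉1 (≈-trans (≈-sym Mii≈0) (M-diagonal i)))
                 , λ i j i≢j nonadj → M-offDiagonal i j i≢j (nonadjacent⇒¬edge nonadj)

module Arithmetic where

  open import Data.Nat using (zero; _+_; _*_; _^_; _/_; _%_; z≤n; s≤s; _<?_; NonZero; >-nonZero)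
  open import Data.Nat.Properties
  open import Data.Nat.DivMod using (m≡m%n+[m/n]*n; m%n<n; m/n*n≤m)
  open import Data.Nat.Solver using (module +-*-Solver)
  open import Data.Fin using (Fin; inject≤; remQuot)
  open import Data.Fin.Properties using (inject≤-injective; *↔×)
  open import Data.Product using (_,_)
  open import Function using (_∘_; Injection)
  open import Function.Properties.Inverse using (↔⇒↣)
  open import Relation.Nullary using (yes; no)
  open import Relation.Binary.PropositionalEquality
  open +-*-Solver

  ^-distribʳ-* : ∀ m n o → (m * n) ^ o ≡ m ^ o * n ^ o
  ^-distribʳ-* m n zero    = refl
  ^-distribʳ-* m n (suc o) = trans (cong (m * n *_) (^-distribʳ-* m n o))
    (solve 4 (λ m n a b → m :* n :* (a :* b) := m :* a :* (n :* b)) refl m n (m ^ o) (n ^ o))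

  ^-swap : ∀ m n o → (m ^ n) ^ o ≡ (m ^ o) ^ n
  ^-swap m n o = trans (^-*-assoc m n o) (trans (cong (m ^_) (*-comm n o)) (sym (^-*-assoc m o n)))

  bernoulli : ∀ x d n → x ^ n * (x + n * d) ≤ (x + d) ^ n * x
  bernoulli x d zero    = ≤-reflexive (solve 1 (λ x → con 1 :* (x :+ con 0) := con 1 :* x) refl x)
  bernoulli x d (suc n) = begin
    x * x ^ n * (x + (d + n * d))
      ≡⟨ solve 4 (λ x d n p → x :* p :* (x :+ (d :+ n :* d)) := p :* (x :* (x :+ (d :+ n :* d)))) refl x d n (x ^ n) ⟩
    x ^ n * (x * (x + (d + n * d)))
      ≤⟨ *-monoʳ-≤ (x ^ n) step ⟩
    x ^ n * ((x + d) * (x + n * d))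
      ≡⟨ solve 4 (λ x d n p → p :* ((x :+ d) :* (x :+ n :* d)) := (x :+ d) :* (p :* (x :+ n :* d))) refl x d n (x ^ n) ⟩
    (x + d) * (x ^ n * (x + n * d))
      ≤⟨ *-monoʳ-≤ (x + d) (bernoulli x d n) ⟩
    (x + d) * ((x + d) ^ n * x)
      ≡⟨ *-assoc (x + d) _ x ⟨
    (x + d) * (x + d) ^ n * x ∎
    where
    open ≤-Reasoning
    step : x * (x + (d + n * d)) ≤ (x + d) * (x + n * d)
    step = begin
      x * (x + (d + n * d))
        ≤⟨ m≤m+n _ (d * (n * d)) ⟩
      x * (x + (d + n * d)) + d * (n * d)
        ≡⟨ solve 3 (λ x d n → x :* (x :+ (d :+ n :* d)) :+ d :* (n :* d) := (x :+ d) :* (x :+ n :* d)) refl x d n ⟩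
      (x + d) * (x + n * d) ∎

  n<2^n : ∀ n → n < 2 ^ n
  n<2^n zero    = s≤s z≤n
  n<2^n (suc n) = begin
    suc (suc n)     ≡⟨ +-comm 1 (suc n) ⟩
    suc n + 1       ≤⟨ +-mono-≤ (n<2^n n) (m^n>0 2 n) ⟩
    2 ^ n + 2 ^ n   ≡⟨ cong (2 ^ n +_) (+-identityʳ (2 ^ n)) ⟨
    2 ^ suc n ∎
    where open ≤-Reasoning

  power-bracket : ∀ B → 1 < B → ∀ n → 0 < n → ∃ λ h → B ^ h ≤ n × n < B ^ suc h
  power-bracket B 1<B (suc zero)    _ = 0 , ≤-refl , subst (1 <_) (sym (*-identityʳ B)) 1<B
  power-bracket B 1<B (suc (suc n)) _ with power-bracket B 1<B (suc n) (s≤s z≤n)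
  ... | h , lo , hi with suc (suc n) <? B ^ suc h
  ...   | yes n+2<B^h+1 = h , m≤n⇒m≤1+n lo , n+2<B^h+1
  ...   | no  n+2≮B^h+1 = suc h , ≮⇒≥ n+2≮B^h+1 , n+2<B^h+2
    where
    instance _ = m^n≢0 B (suc h) {{>-nonZero (<-trans (s≤s z≤n) 1<B)}}
    n+2<B^h+2 : suc (suc n) < B * B ^ suc h
    n+2<B^h+2 = ≤-trans (s≤s hi) (≤-trans (m<m*n (B ^ suc h) B 1<B) (≤-reflexive (*-comm (B ^ suc h) B)))

  module _ {r n E μ ν K f Q : ℕ} .{{_ : NonZero ν}} where

    -- Read over the reals: r ≤ n E (μ/ν)^f and n E^Q ≤ K^f ≤ (ν/μ)^(Q f) give r ≤ n^(1-1/Q).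
    decay⇒BoundedBy : r * ν ^ f ≤ n * E * μ ^ f → n * E ^ Q ≤ K ^ f → K * μ ^ Q ≤ ν ^ Q →
                      BoundedBy r n 1 Q
    decay⇒BoundedBy decay small K≤ = *-cancelʳ-≤ _ _ ((ν ^ f) ^ Q) {{m^n≢0 (ν ^ f) Q {{m^n≢0 ν f}}}} (begin
      r ^ Q * (n * 1) * (ν ^ f) ^ Q
        ≡⟨ solve 3 (λ a n b → a :* (n :* con 1) :* b := n :* (a :* b)) refl (r ^ Q) n ((ν ^ f) ^ Q) ⟩
      n * (r ^ Q * (ν ^ f) ^ Q)
        ≡⟨ cong (n *_) (^-distribʳ-* r (ν ^ f) Q) ⟨
      n * (r * ν ^ f) ^ Q
        ≤⟨ *-monoʳ-≤ n (^-monoˡ-≤ Q decay) ⟩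
      n * (n * E * μ ^ f) ^ Q
        ≡⟨ cong (n *_) (trans (^-distribʳ-* (n * E) (μ ^ f) Q) (cong (_* (μ ^ f) ^ Q) (^-distribʳ-* n E Q))) ⟩
      n * (n ^ Q * E ^ Q * (μ ^ f) ^ Q)
        ≡⟨ solve 4 (λ n a e m → n :* (a :* e :* m) := a :* (n :* e :* m)) refl n (n ^ Q) (E ^ Q) ((μ ^ f) ^ Q) ⟩
      n ^ Q * (n * E ^ Q * (μ ^ f) ^ Q)
        ≤⟨ *-monoʳ-≤ (n ^ Q) (*-monoˡ-≤ ((μ ^ f) ^ Q) small) ⟩
      n ^ Q * (K ^ f * (μ ^ f) ^ Q)
        ≡⟨ cong (λ e → n ^ Q * (K ^ f * e)) (^-swap μ f Q) ⟩
      n ^ Q * (K ^ f * (μ ^ Q) ^ f)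
        ≡⟨ cong (n ^ Q *_) (^-distribʳ-* K (μ ^ Q) f) ⟨
      n ^ Q * (K * μ ^ Q) ^ f
        ≤⟨ *-monoʳ-≤ (n ^ Q) (^-monoˡ-≤ f K≤) ⟩
      n ^ Q * (ν ^ Q) ^ f
        ≡⟨ cong (n ^ Q *_) (^-swap ν Q f) ⟩
      n ^ Q * (ν ^ f) ^ Q ∎)
      where open ≤-Reasoning

  packing : ∀ n N .{{_ : NonZero N}} → Σ (Fin n → Fin (suc (n / N)) × Fin N) (Injective _≡_ _≡_)
  packing n N =
    remQuot N ∘ (λ i → inject≤ i n≤) , λ eq → inject≤-injective n≤ n≤ _ _ (Injection.injective (↔⇒↣ *↔×) eq)
    where
    n≤ : n ≤ suc (n / N) * N
    n≤ = begin
      n                    ≡⟨ m≡m%n+[m/n]*n n N ⟩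
      n % N + n / N * N    ≤⟨ +-monoˡ-≤ (n / N * N) (<⇒≤ (m%n<n n N)) ⟩
      N + n / N * N ∎
      where open ≤-Reasoning

  packing-size : ∀ n N .{{_ : NonZero N}} → suc (n / N) * N ≤ N + n
  packing-size n N = +-monoʳ-≤ N (m/n*n≤m n N)

module Parameters (ℓ : ℕ) where

  open import Data.Nat using (_+_; _*_; _^_; z≤n; s≤s; NonZero)
  open import Data.Nat.Properties
  open import Data.Nat.Solver using (module +-*-Solver)
  open import Relation.Binary.PropositionalEquality
  open +-*-Solver
  open Arithmetic using (bernoulli; n<2^n)

  -- Below D + f the ratio of consecutive binomial coefficients (k choose ·) is at most μ/ν.
  μ ν K q Q E B h₀ : ℕ
  μ  = suc (2 * ℓ)
  ν  = μ + 2
  K  = 2 ^ (2 + 8 * suc ℓ)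
  q  = K * μ
  Q  = suc q
  E  = 4 * suc ℓ * Q
  B  = 2 ^ E
  h₀ = 4 * ℓ * Q

  K*μ^Q≤ν^Q : K * μ ^ Q ≤ ν ^ Q
  K*μ^Q≤ν^Q = *-cancelʳ-≤ _ _ μ (begin
    K * μ ^ Q * μ      ≡⟨ solve 3 (λ k p m → k :* p :* m := p :* (k :* m)) refl K (μ ^ Q) μ ⟩
    μ ^ Q * (K * μ)    ≤⟨ *-monoʳ-≤ (μ ^ Q) (≤-trans (n≤1+n q) (≤-trans (m≤m*n Q 2) (m≤n+m (Q * 2) μ))) ⟩
    μ ^ Q * (μ + Q * 2) ≤⟨ bernoulli μ 2 Q ⟩
    ν ^ Q * μ ∎)
    where open ≤-Reasoning

  B>1 : 1 < B
  B>1 = ^-monoʳ-< 2 (s≤s (s≤s z≤n)) {0} {E} (s≤s z≤n)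

  instance
    B≢0 : NonZero B
    B≢0 = m^n≢0 2 E

  module Scale (ℓ>0 : 0 < ℓ) (h : ℕ) (h₀≤h : h₀ ≤ h) where

    f k T D w : ℕ
    f = Q * h
    k = 4 * suc ℓ * f
    T = 4 * f
    D = 2 * ℓ * f
    w = D + f

    h>0 : 0 < h
    h>0 = ≤-trans (*-mono-≤ (*-mono-≤ (s≤s (z≤n {3})) ℓ>0) (s≤s (z≤n {q}))) h₀≤h

    f>0 : 0 < f
    f>0 = *-mono-≤ (s≤s (z≤n {q})) h>0

    D>0 : 0 < D
    D>0 = *-mono-≤ (*-mono-≤ (s≤s (z≤n {1})) ℓ>0) f>0

    k≡T+2D : k ≡ T + (D + D)
    k≡T+2D = solve 2 (λ ℓ f → con 4 :* (con 1 :+ ℓ) :* f := con 4 :* f :+ (con 2 :* ℓ :* f :+ con 2 :* ℓ :* f)) refl ℓ f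

    D+D≤k : D + D ≤ k
    D+D≤k = ≤-trans (m≤n+m (D + D) T) (≤-reflexive (sym k≡T+2D))

    w≤k : w ≤ k
    w≤k = ≤-trans (m≤m+n w (ν * f)) (≤-reflexive (solve 2 (λ ℓ f → con 2 :* ℓ :* f :+ f :+ ((con 1 :+ con 2 :* ℓ) :+ con 2) :* f
                                                          := con 4 :* (con 1 :+ ℓ) :* f) refl ℓ f))

    Tℓ<k : T * ℓ < k
    Tℓ<k = ≤-trans (m<m+n (T * ℓ) (≤-trans f>0 (m≤n*m f 4)))
             (≤-reflexive (solve 2 (λ ℓ f → con 4 :* f :* ℓ :+ con 4 :* f := con 4 :* (con 1 :+ ℓ) :* f) refl ℓ f))

    decay-condition : w * ν + w * μ ≤ k * μ
    decay-condition = ≤-reflexive (solve 2 (λ ℓ f → (con 2 :* ℓ :* f :+ f) :* ((con 1 :+ con 2 :* ℓ) :+ con 2) :+ (con 2 :* ℓ :* f :+ f) :* (con 1 :+ con 2 :* ℓ)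
                                                 := con 4 :* (con 1 :+ ℓ) :* f :* (con 1 :+ con 2 :* ℓ)) refl ℓ f)

    2^k≡B^h : 2 ^ k ≡ B ^ h
    2^k≡B^h = trans (cong (2 ^_) (solve 3 (λ ℓ q h → con 4 :* (con 1 :+ ℓ) :* (q :* h) := con 4 :* (con 1 :+ ℓ) :* q :* h) refl ℓ Q h))
                    (sym (^-*-assoc 2 E h))

    D+D≤2^[h+h] : D + D ≤ 2 ^ (h + h)
    D+D≤2^[h+h] = begin
      D + D
        ≡⟨ solve 3 (λ ℓ q h → con 2 :* ℓ :* (q :* h) :+ con 2 :* ℓ :* (q :* h) := con 4 :* ℓ :* q :* h) refl ℓ Q h ⟩
      h₀ * h
        ≤⟨ *-monoˡ-≤ h h₀≤h ⟩
      h * h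
        ≤⟨ *-mono-≤ (<⇒≤ (n<2^n h)) (<⇒≤ (n<2^n h)) ⟩
      2 ^ h * 2 ^ h
        ≡⟨ ^-distribˡ-+-* 2 h h ⟨
      2 ^ (h + h) ∎
      where open ≤-Reasoning

    n[D+D]^Q≤K^f : ∀ {n} → n < B ^ suc h → n * (D + D) ^ Q ≤ K ^ f
    n[D+D]^Q≤K^f {n} n<B^h+1 = begin
      n * (D + D) ^ Q
        ≤⟨ *-mono-≤ (<⇒≤ n<B^h+1) (^-monoˡ-≤ Q D+D≤2^[h+h]) ⟩
      B ^ suc h * (2 ^ (h + h)) ^ Q
        ≤⟨ *-monoˡ-≤ _ (^-monoʳ-≤ B (+-monoˡ-≤ h h>0)) ⟩
      B ^ (h + h) * (2 ^ (h + h)) ^ Q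
        ≡⟨ cong₂ _*_ (^-*-assoc 2 E (h + h)) (^-*-assoc 2 (h + h) Q) ⟩
      2 ^ (E * (h + h)) * 2 ^ ((h + h) * Q)
        ≡⟨ ^-distribˡ-+-* 2 (E * (h + h)) ((h + h) * Q) ⟨
      2 ^ (E * (h + h) + (h + h) * Q)
        ≡⟨ cong (2 ^_) (solve 3 (λ ℓ q h → con 4 :* (con 1 :+ ℓ) :* q :* (h :+ h) :+ (h :+ h) :* q
                                                                          := (con 2 :+ con 8 :* (con 1 :+ ℓ)) :* (q :* h)) refl ℓ Q h) ⟩
      2 ^ ((2 + 8 * suc ℓ) * f)
        ≡⟨ ^-*-assoc 2 (2 + 8 * suc ℓ) f ⟨
      K ^ f ∎
      where open ≤-Reasoning

module Instance (ℓ : ℕ) (ℓ>0 : 0 < ℓ) (n : ℕ) (B^h₀≤n : Parameters.B ℓ ℕ.^ Parameters.h₀ ℓ ≤ n) where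

  open import Data.Nat using (_+_; _*_; _^_; _/_; NonZero; >-nonZero)
  open import Data.Nat.Properties
  open import Data.Nat.Solver using (module +-*-Solver)
  open import Data.Product using (_,_; proj₁; proj₂)
  open import Data.Product.Properties using (,-injectiveˡ; ,-injectiveʳ)
  open import Relation.Binary.PropositionalEquality
  open +-*-Solver
  open Parameters ℓ
  open Arithmetic using (power-bracket; packing; packing-size; decay⇒BoundedBy)
  open Binomial

  bracket : ∃ λ h → B ^ h ≤ n × n < B ^ suc h
  bracket = power-bracket B B>1 n (<-≤-trans (m^n>0 B h₀) B^h₀≤n)

  h : ℕ
  h = proj₁ bracket

  n<B^h+1 : n < B ^ suc h
  n<B^h+1 = proj₂ (proj₂ bracket)

  h₀≤h : h₀ ≤ h
  h₀≤h = ≮⇒≥ λ h<h₀ → <⇒≱ n<B^h+1 (≤-trans (^-monoʳ-≤ B h<h₀) B^h₀≤n)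

  open Scale ℓ>0 h h₀≤h

  N : ℕ
  N = k choose w

  instance
    N≢0 : NonZero N
    N≢0 = >-nonZero (choose>0 w≤k)

  N≤n : N ≤ n
  N≤n = ≤-trans (choose≤2^ k w) (≤-trans (≤-reflexive 2^k≡B^h) (proj₁ (proj₂ bracket)))

  m : ℕ
  m = suc (n / N)

  label : Fin n → Fin m × Vec Bool k
  label i = proj₁ (proj₁ (packing n N) i) , ofWeight k w (proj₂ (proj₁ (packing n N) i))

  label-injective : Injective _≡_ _≡_ label
  label-injective eq = proj₂ (packing n N) (cong₂ _,_ (,-injectiveˡ eq) (ofWeight-injective k w (,-injectiveʳ eq)))

  open Construction T D label label-injective (λ i → weight-ofWeight k w _) k≡T+2D D>0 public

  graph-noShortOddCycle : NoShortOddCycle graph ℓ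
  graph-noShortOddCycle = noShortOddCycle ℓ Tℓ<k

  r : ℕ
  r = m * k choose< D

  r-bound : BoundedBy r n 1 Q
  r-bound = decay⇒BoundedBy {r} {n} {D + D} {μ} {ν} {K} {f} {Q} decay (n[D+D]^Q≤K^f n<B^h+1) K*μ^Q≤ν^Q
    where
    decay : r * ν ^ f ≤ n * (D + D) * μ ^ f
    decay = *-cancelʳ-≤ _ _ N (begin
      r * ν ^ f * N
        ≡⟨ solve 4 (λ m c v N → m :* c :* v :* N := m :* N :* (c :* v)) refl m (k choose< D) (ν ^ f) N ⟩
      m * N * (k choose< D * ν ^ f)
        ≤⟨ *-mono-≤ (packing-size n N) (choose<-decay D f D+D≤k decay-condition) ⟩
      (N + n) * (D * N * μ ^ f)
        ≤⟨ *-monoˡ-≤ _ (+-monoˡ-≤ n N≤n) ⟩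
      (n + n) * (D * N * μ ^ f)
        ≡⟨ solve 4 (λ n D N u → (n :+ n) :* (D :* N :* u) := n :* (D :+ D) :* u :* N) refl n D N (μ ^ f) ⟩
      n * (D + D) * μ ^ f * N ∎)
      where open ≤-Reasoning

theorem3p7 : ∀ (ℓ : ℕ) → 3 ≤ ℓ → Odd ℓ →
    Σ ℕ λ p → Σ ℕ λ q → 0 < p ×
      (Σ ℕ λ N → ∀ (n : ℕ) → N ≤ n →
        Σ (Graph n) λ G → NoShortOddCycle G ℓ ×
          (∀ (F : FiniteField) →
            (Σ ℕ λ r → BoundedBy r n p (suc q) × MinrkAtMost (FiniteField.field′ F) G r) ×
            (Σ ℕ λ r → BoundedBy r n p (suc q) × SymMinrkAtMost (FiniteField.field′ F) G r)))
theorem3p7 ℓ 3≤ℓ _ = 1 , q , s≤s z≤n , B ^ h₀ , λ n B^h₀≤n →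
  let open Instance ℓ (≤-trans (s≤s z≤n) 3≤ℓ) n B^h₀≤n in
  graph , graph-noShortOddCycle , λ F →
    let open Representation (FiniteField.field′ F) in
    (r , r-bound , M , M-represents , M-rank) , (r , r-bound , M , M-symmetric , M-represents , M-rank)
  where
  open Parameters ℓ using (q; B; h₀)
  open import Data.Nat using (_^_; s≤s; z≤n)
  open import Data.Nat.Properties using (≤-trans)
  open import Data.Product using (_,_)
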